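{- Let $n\ge 2$, $e=e_1\cdots e_n\in\mathbf{I}_n(0012)$ with $e\ne 01\cdots(n-1)$, and let $\gamma(e)=e_1\cdots e_{n-1}$. Then: (a) if $\textsc{last}(e)>\textsc{srpt}(\gamma(e))$, then $\textsc{srpt}(e)=\textsc{srpt}(\gamma(e))$; (b) if $\textsc{last}(e)\le\textsc{srpt}(\gamma(e))$, then $\textsc{srpt}(e)=\textsc{last}(e)$.
   Context: An inversion sequence of length $n$ is a sequence $e=e_1\cdots e_n$ of integers with $0\le e_i\le i-1$. The reduction of a word replaces each occurrence of the $k$-th smallest distinct entry by $k-1$; $e$ contains a pattern $p$ if some subsequence (entries at increasing positions) has reduction $p$, and avoids $p$ otherwise. $\mathbf{I}_n(0012)$ is the set of inversion sequences of length $n$ avoiding $0012$. For an inversion sequence $e$ of length $m$ avoiding $0012$, $\mathcal{R}(e)$ is the set of values appearing at least twice in $e$, $\textsc{srpt}(e)=\min\mathcal{R}(e)$, with the convention $\textsc{srpt}(01\cdots(m-1))=m-1$ for the sequence with no repeated values; and $\textsc{last}(e)=e_m$ is the last entry. -}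

module Defs where

open import Data.Nat using (ℕ; zero; suc; _≤_; _<_; _∸_; _<?_; _≤?_; _⊓_)
open import Data.Nat.Properties using (_≟_)
open import Data.Fin using (Fin; toℕ) renaming (_<_ to _<ᶠ_)
open import Data.Vec using (Vec; lookup; tabulate; toList)
open import Data.List using (List; []; _∷_; length; filter; deduplicate)
open import Data.Maybe using (Maybe; just; nothing; maybe)
open import Data.Product using (Σ; _×_)
open import Relation.Binary.PropositionalEquality using (_≡_)
open import Relation.Nullary using (¬_)

-- Inversion sequence of length n (0-indexed position i holds e_{i+1} ≤ i).
IsInvSeq : ∀ {n} → Vec ℕ n → Set
IsInvSeq {n} e = (i : Fin n) → lookup e i ≤ toℕ i

-- Reduction of a word: each entry is replaced by the number of distinct
-- values of the word strictly smaller than it (k-th smallest ↦ k-1).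
reduction : ∀ {k} → Vec ℕ k → Vec ℕ k
reduction w =
  tabulate (λ a → length (deduplicate _≟_ (filter (_<? lookup w a) (toList w))))

Contains : ∀ {n k} → Vec ℕ n → Vec ℕ k → Set
Contains {n} {k} e p =
  Σ (Fin k → Fin n) λ f →
    ((a b : Fin k) → a <ᶠ b → f a <ᶠ f b) ×
    (reduction (tabulate (λ a → lookup e (f a))) ≡ p)

Avoids : ∀ {n k} → Vec ℕ n → Vec ℕ k → Set
Avoids e p = ¬ Contains e p

p0012 : Vec ℕ 4
p0012 = Data.Vec._∷_ 0 (Data.Vec._∷_ 0 (Data.Vec._∷_ 1 (Data.Vec._∷_ 2 Data.Vec.[])))

InI0012 : ∀ {n} → Vec ℕ n → Set
InI0012 e = IsInvSeq e × Avoids e p0012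

idSeq : (n : ℕ) → Vec ℕ n
idSeq n = tabulate toℕ

occ : ℕ → List ℕ → ℕ
occ x l = length (filter (x ≟_) l)

minRepeated : List ℕ → List ℕ → Maybe ℕ
minRepeated whole [] = nothing
minRepeated whole (x ∷ xs) with 2 ≤? occ x whole | minRepeated whole xs
... | Relation.Nullary.yes _ | nothing = just x
... | Relation.Nullary.yes _ | just m  = just (x ⊓ m)
... | Relation.Nullary.no _  | r       = r

-- srpt(e) = min R(e); if R(e) is empty, srpt = m - 1 (m = length of e).
srpt : ∀ {m} → Vec ℕ m → ℕ
srpt {m} e = maybe (λ v → v) (m ∸ 1) (minRepeated (toList e) (toList e))

module Submission where

-- In an inversion sequence in which no value below v is repeated, every position i ≤ v holds i:
-- an entry w < i would repeat the entry w already sitting at position w. Hence a last entry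
-- x ≤ srpt(γ(e)) already occurs in γ(e) and becomes the least repeated value of e, while a
-- larger x repeats only values above srpt(γ(e)). If γ(e) has no repetition it is 01⋯(m−1), and
-- then x > m−1 would force e = 01⋯m.

open import Defs
open import Data.Nat using (ℕ; zero; suc; _+_; _∸_; _≤_; _<_; _⊓_; z≤n; s≤s; s≤s⁻¹; _≤?_)
open import Data.Nat.Properties
open import Data.Fin using (toℕ; fromℕ<; inject₁) renaming (zero to fzero; suc to fsuc)
open import Data.Fin.Properties using (toℕ-fromℕ<; toℕ-inject₁; toℕ<n)
open import Data.Vec using (Vec; _∷_; _∷ʳ_; init; last; lookup; toList; initLast)
open import Data.Vec.Properties using (tabulate∘lookup; tabulate-cong; toList-∷ʳ)
open import Data.List using (List; []; _∷_; length; filter; _++_; [_])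
import Data.List.Properties as List
open import Data.Maybe using (Maybe; just; nothing; maybe)
open import Data.Product using (∃; _×_; _,_; proj₂; map)
open import Data.Sum using (_⊎_; inj₁; inj₂)
open import Data.Empty using (⊥-elim)
open import Function using (id; _∘_)
open import Relation.Nullary using (¬_; yes; no; contradiction)
open import Relation.Binary.PropositionalEquality
  using (_≡_; _≢_; refl; sym; trans; cong; subst; subst₂)

Occurs : List ℕ → ℕ → Set
Occurs l y = 1 ≤ occ y l

Repeated : List ℕ → ℕ → Set
Repeated l y = 2 ≤ occ y l

IsLeastRepeated : List ℕ → ℕ → Set
IsLeastRepeated l v = Repeated l v × (∀ y → Repeated l y → v ≤ y)

repeated⇒occurs : ∀ l {y} → Repeated l y → Occurs l y
repeated⇒occurs _ = ≤-trans (s≤s z≤n)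

occ-∷-≡ : ∀ {y z} l → y ≡ z → occ y (z ∷ l) ≡ suc (occ y l)
occ-∷-≡ {y} l y≡z = cong length (List.filter-accept (y ≟_) y≡z)

occ-∷-≢ : ∀ {y z} l → y ≢ z → occ y (z ∷ l) ≡ occ y l
occ-∷-≢ {y} l y≢z = cong length (List.filter-reject (y ≟_) y≢z)

occ-≤-∷ : ∀ y z l → occ y l ≤ occ y (z ∷ l)
occ-≤-∷ y z l with y ≟ z
... | yes y≡z = ≤-trans (n≤1+n _) (≤-reflexive (sym (occ-∷-≡ l y≡z)))
... | no y≢z = ≤-reflexive (sym (occ-∷-≢ l y≢z))

occurs-head : ∀ y l → Occurs (y ∷ l) y
occurs-head y l = ≤-trans (s≤s z≤n) (≤-reflexive (sym (occ-∷-≡ {y} l refl)))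

occurs-∷⁻ : ∀ {y z} l → Occurs (z ∷ l) y → y ≡ z ⊎ Occurs l y
occurs-∷⁻ {y} {z} l y∈ with y ≟ z
... | yes y≡z = inj₁ y≡z
... | no y≢z = inj₂ (subst (1 ≤_) (occ-∷-≢ l y≢z) y∈)

occurs-∷-elim : ∀ (P : ℕ → Set) {z} l → P z → (∀ y → Occurs l y → P y) → ∀ y → Occurs (z ∷ l) y → P y
occurs-∷-elim P {z} l pz pl y y∈ with occurs-∷⁻ {y} {z} l y∈
... | inj₁ refl = pz
... | inj₂ y∈l = pl y y∈l

occ-++ : ∀ y l r → occ y (l ++ r) ≡ occ y l + occ y r
occ-++ y l r = trans (cong length (List.filter-++ (y ≟_) l r)) (List.length-++ (filter (y ≟_) l))

occ-≤-++ : ∀ y l r → occ y l ≤ occ y (l ++ r)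
occ-≤-++ y l r = ≤-trans (m≤m+n _ _) (≤-reflexive (sym (occ-++ y l r)))

occ-∷ʳ-≡ : ∀ x l → occ x (l ++ [ x ]) ≡ suc (occ x l)
occ-∷ʳ-≡ x l = trans (occ-++ x l [ x ]) (trans (cong (occ x l +_) (occ-∷-≡ {x} [] refl)) (+-comm (occ x l) 1))

occ-∷ʳ-≢ : ∀ {y x} l → y ≢ x → occ y (l ++ [ x ]) ≡ occ y l
occ-∷ʳ-≢ {y} {x} l y≢x = trans (occ-++ y l [ x ]) (trans (cong (occ y l +_) (occ-∷-≢ [] y≢x)) (+-identityʳ _))

repeated-∷ʳ⁻ : ∀ {x y} l → Repeated (l ++ [ x ]) y → Repeated l y ⊎ (y ≡ x × Occurs l x)
repeated-∷ʳ⁻ {x} {y} l r with y ≟ x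
... | yes refl = inj₂ (refl , s≤s⁻¹ (subst (2 ≤_) (occ-∷ʳ-≡ x l) r))
... | no y≢x = inj₁ (subst (2 ≤_) (occ-∷ʳ-≢ l y≢x) r)

repeated-∷ʳ-self : ∀ {x} l → Occurs l x → Repeated (l ++ [ x ]) x
repeated-∷ʳ-self {x} l x∈ = subst (2 ≤_) (sym (occ-∷ʳ-≡ x l)) (s≤s x∈)

isLeastRepeated-∷ʳ-keep : ∀ {s x} l → IsLeastRepeated l s → s < x → IsLeastRepeated (l ++ [ x ]) s
isLeastRepeated-∷ʳ-keep {s} {x} l (rs , below) s<x = ≤-trans rs (occ-≤-++ s l [ x ]) , bound
  where
  bound : ∀ y → Repeated (l ++ [ x ]) y → s ≤ y
  bound y ry with repeated-∷ʳ⁻ l ry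
  ... | inj₁ ry′ = below y ry′
  ... | inj₂ (refl , _) = <⇒≤ s<x

isLeastRepeated-∷ʳ-self : ∀ {x} l → Occurs l x → (∀ y → Repeated l y → x ≤ y) → IsLeastRepeated (l ++ [ x ]) x
isLeastRepeated-∷ʳ-self {x} l x∈ below = repeated-∷ʳ-self l x∈ , bound
  where
  bound : ∀ y → Repeated (l ++ [ x ]) y → x ≤ y
  bound y ry with repeated-∷ʳ⁻ l ry
  ... | inj₁ ry′ = below y ry′
  ... | inj₂ (refl , _) = ≤-refl

data MinRepeatedSpec (w l : List ℕ) : Maybe ℕ → Set where
  none  : (∀ y → Occurs l y → ¬ Repeated w y) → MinRepeatedSpec w l nothing
  least : ∀ {v} → Repeated w v → (∀ y → Occurs l y → Repeated w y → v ≤ y) → MinRepeatedSpec w l (just v)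

minRepeated-spec : ∀ w l → MinRepeatedSpec w l (minRepeated w l)
minRepeated-spec w [] = none (λ _ ())
minRepeated-spec w (x ∷ xs) with 2 ≤? occ x w | minRepeated w xs | minRepeated-spec w xs
... | yes rx | nothing | none free =
  least rx (occurs-∷-elim (λ y → Repeated w y → x ≤ y) xs (λ _ → ≤-refl) (λ y y∈ ry → ⊥-elim (free y y∈ ry)))
... | yes rx | just m | least rm bound =
  least rx⊓m (occurs-∷-elim (λ y → Repeated w y → x ⊓ m ≤ y) xs
                (λ _ → m⊓n≤m x m) (λ y y∈ ry → ≤-trans (m⊓n≤n x m) (bound y y∈ ry)))
  where
  rx⊓m : Repeated w (x ⊓ m)
  rx⊓m with ⊓-sel x m
  ... | inj₁ eq = subst (Repeated w) (sym eq) rx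
  ... | inj₂ eq = subst (Repeated w) (sym eq) rm
... | no ¬rx | nothing | none free = none (occurs-∷-elim (λ y → ¬ Repeated w y) xs ¬rx free)
... | no ¬rx | just m | least rm bound =
  least rm (occurs-∷-elim (λ y → Repeated w y → m ≤ y) xs (λ rx → contradiction rx ¬rx) bound)

leastRepeated-or-free : ∀ l → (∃ λ v → IsLeastRepeated l v) ⊎ (∀ y → ¬ Repeated l y)
leastRepeated-or-free l with minRepeated l l | minRepeated-spec l l
... | nothing | none free = inj₂ (λ y ry → free y (repeated⇒occurs l ry) ry)
... | just v | least rv bound = inj₁ (v , rv , λ y ry → bound y (repeated⇒occurs l ry) ry)

minRepeated-least : ∀ l {v} → IsLeastRepeated l v → minRepeated l l ≡ just v
minRepeated-least l {v} (rv , below) with minRepeated l l | minRepeated-spec l l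
... | nothing | none free = ⊥-elim (free v (repeated⇒occurs l rv) rv)
... | just u | least ru bound = cong just (≤-antisym (bound v (repeated⇒occurs l rv) rv) (below u ru))

minRepeated-free : ∀ l → (∀ y → ¬ Repeated l y) → minRepeated l l ≡ nothing
minRepeated-free l free with minRepeated l l | minRepeated-spec l l
... | nothing | _ = refl
... | just _ | least rv _ = ⊥-elim (free _ rv)

srpt-least : ∀ {n v} (g : Vec ℕ n) → IsLeastRepeated (toList g) v → srpt g ≡ v
srpt-least {n} g lv = cong (maybe id (n ∸ 1)) (minRepeated-least (toList g) lv)

srpt-free : ∀ {n} (g : Vec ℕ n) → (∀ y → ¬ Repeated (toList g) y) → srpt g ≡ n ∸ 1
srpt-free {n} g free = cong (maybe id (n ∸ 1)) (minRepeated-free (toList g) free)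

srpt-∷ʳ-least : ∀ {n v} (g : Vec ℕ n) x → IsLeastRepeated (toList g ++ [ x ]) v → srpt (g ∷ʳ x) ≡ v
srpt-∷ʳ-least {v = v} g x lv = srpt-least (g ∷ʳ x) (subst (λ l → IsLeastRepeated l v) (sym (toList-∷ʳ x g)) lv)

occurs-lookup : ∀ {n} (g : Vec ℕ n) i → Occurs (toList g) (lookup g i)
occurs-lookup (y ∷ g) fzero = occurs-head y (toList g)
occurs-lookup (y ∷ g) (fsuc i) = ≤-trans (occurs-lookup g i) (occ-≤-∷ _ y (toList g))

occurs⇒lookup : ∀ {n y} (g : Vec ℕ n) → Occurs (toList g) y → ∃ λ i → lookup g i ≡ y
occurs⇒lookup (z ∷ g) y∈ with occurs-∷⁻ (toList g) y∈
... | inj₁ y≡z = fzero , sym y≡z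
... | inj₂ y∈g with occurs⇒lookup g y∈g
...   | i , eq = fsuc i , eq

repeated-lookup : ∀ {n} (g : Vec ℕ n) i j → i ≢ j → lookup g i ≡ lookup g j → Repeated (toList g) (lookup g i)
repeated-lookup (y ∷ g) fzero fzero i≢j _ = contradiction refl i≢j
repeated-lookup (y ∷ g) fzero (fsuc j) _ eq =
  subst (2 ≤_) (sym (occ-∷-≡ (toList g) refl)) (s≤s (subst (Occurs (toList g)) (sym eq) (occurs-lookup g j)))
repeated-lookup (y ∷ g) (fsuc i) fzero _ eq =
  subst (Repeated (y ∷ toList g)) (sym eq) (repeated-lookup (y ∷ g) fzero (fsuc i) (λ ()) (sym eq))
repeated-lookup (y ∷ g) (fsuc i) (fsuc j) i≢j eq =
  ≤-trans (repeated-lookup g i j (i≢j ∘ cong fsuc) eq) (occ-≤-∷ _ y (toList g))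

lookup-∷ʳ-inject₁ : ∀ {n} (g : Vec ℕ n) x i → lookup (g ∷ʳ x) (inject₁ i) ≡ lookup g i
lookup-∷ʳ-inject₁ (y ∷ g) x fzero = refl
lookup-∷ʳ-inject₁ (y ∷ g) x (fsuc i) = lookup-∷ʳ-inject₁ g x i

isInvSeq-init : ∀ {n} (g : Vec ℕ n) x → IsInvSeq (g ∷ʳ x) → IsInvSeq g
isInvSeq-init g x inv i = subst₂ _≤_ (lookup-∷ʳ-inject₁ g x i) (toℕ-inject₁ i) (inv (inject₁ i))

invSeq-value< : ∀ {n y} (g : Vec ℕ n) → IsInvSeq g → Occurs (toList g) y → y < n
invSeq-value< g inv y∈ with occurs⇒lookup g y∈
... | i , refl = ≤-<-trans (inv i) (toℕ<n i)

invSeq-fixed-step : ∀ {n} (g : Vec ℕ n) → IsInvSeq g → ∀ i →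
  (∀ w → w < toℕ i → ¬ Repeated (toList g) w) → (∀ j → toℕ j < toℕ i → lookup g j ≡ toℕ j) →
  lookup g i ≡ toℕ i
invSeq-fixed-step g inv i free earlier with lookup g i ≟ toℕ i
... | yes fixed = fixed
... | no unfixed = contradiction (repeated-lookup g i j i≢j (sym gj≡w)) (free w w<i)
  where
  w = lookup g i
  w<i : w < toℕ i
  w<i = ≤∧≢⇒< (inv i) unfixed
  w<n = <-trans w<i (toℕ<n i)
  j = fromℕ< w<n
  gj≡w : lookup g j ≡ w
  gj≡w = trans (earlier j (subst (_< toℕ i) (sym (toℕ-fromℕ< w<n)) w<i)) (toℕ-fromℕ< w<n)
  i≢j : i ≢ j
  i≢j i≡j = <-irrefl (trans (sym (toℕ-fromℕ< w<n)) (cong toℕ (sym i≡j))) w<i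

invSeq-fixes : ∀ {n} v (g : Vec ℕ n) → IsInvSeq g → (∀ w → w < v → ¬ Repeated (toList g) w) →
  ∀ i → toℕ i ≤ v → lookup g i ≡ toℕ i
invSeq-fixes zero g inv free i i≤0 =
  invSeq-fixed-step g inv i (λ w w<i → free w (<-≤-trans w<i i≤0)) (λ j j<i → contradiction (<-≤-trans j<i i≤0) n≮0)
invSeq-fixes (suc v) g inv free i i≤1+v =
  invSeq-fixed-step g inv i (λ w w<i → free w (<-≤-trans w<i i≤1+v))
    (λ j j<i → invSeq-fixes v g inv (λ w w<v → free w (m<n⇒m<1+n w<v)) j (s≤s⁻¹ (<-≤-trans j<i i≤1+v)))

invSeq-occurs : ∀ {n v} (g : Vec ℕ n) → IsInvSeq g → v < n → (∀ w → w < v → ¬ Repeated (toList g) w) →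
  Occurs (toList g) v
invSeq-occurs {v = v} g inv v<n free =
  subst (Occurs (toList g)) gi≡v (occurs-lookup g i)
  where
  i = fromℕ< v<n
  gi≡v : lookup g i ≡ v
  gi≡v = trans (invSeq-fixes v g inv free i (≤-reflexive (toℕ-fromℕ< v<n))) (toℕ-fromℕ< v<n)

invSeq-free⇒idSeq : ∀ {n} (g : Vec ℕ n) → IsInvSeq g → (∀ w → ¬ Repeated (toList g) w) → g ≡ idSeq n
invSeq-free⇒idSeq g inv free =
  trans (sym (tabulate∘lookup g)) (tabulate-cong λ i → invSeq-fixes (toℕ i) g inv (λ w _ → free w) i ≤-refl)

srpt-∷ʳ : ∀ {k} (g : Vec ℕ (suc k)) x → IsInvSeq (g ∷ʳ x) → g ∷ʳ x ≢ idSeq (suc (suc k)) →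
  (srpt g < x → srpt (g ∷ʳ x) ≡ srpt g) × (x ≤ srpt g → srpt (g ∷ʳ x) ≡ x)
srpt-∷ʳ {k} g x inv ≢id with leastRepeated-or-free (toList g)
... | inj₁ (s , ls@(rs , below)) rewrite srpt-least g ls =
  (λ s<x → srpt-∷ʳ-least g x (isLeastRepeated-∷ʳ-keep (toList g) ls s<x)) ,
  (λ x≤s → srpt-∷ʳ-least g x (isLeastRepeated-∷ʳ-self (toList g) (x-occurs x≤s) (λ y ry → ≤-trans x≤s (below y ry))))
  where
  invG = isInvSeq-init g x inv
  x-occurs : x ≤ s → Occurs (toList g) x
  x-occurs x≤s = invSeq-occurs g invG (≤-<-trans x≤s (invSeq-value< g invG (repeated⇒occurs (toList g) rs)))
                   (λ w w<x rw → <⇒≱ w<x (≤-trans x≤s (below w rw)))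
... | inj₂ free rewrite srpt-free g free =
  (λ k<x → contradiction (invSeq-free⇒idSeq (g ∷ʳ x) inv (free-∷ʳ k<x)) ≢id) ,
  (λ x≤k → srpt-∷ʳ-least g x (isLeastRepeated-∷ʳ-self (toList g)
              (invSeq-occurs g invG (s≤s x≤k) (λ w _ → free w)) (λ y ry → contradiction ry (free y))))
  where
  invG = isInvSeq-init g x inv
  free-∷ʳ : k < x → ∀ y → ¬ Repeated (toList (g ∷ʳ x)) y
  free-∷ʳ k<x y ry with repeated-∷ʳ⁻ (toList g) (subst (λ l → Repeated l y) (toList-∷ʳ x g) ry)
  ... | inj₁ ry′ = free y ry′
  ... | inj₂ (_ , x∈) = <⇒≱ (invSeq-value< g invG x∈) k<x

lemma2p2 : (m : ℕ) → 1 ≤ m → (e : Vec ℕ (suc m)) → InI0012 e →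
    e ≢ idSeq (suc m) →
    ((srpt (init e) < last e → srpt e ≡ srpt (init e)) ×
     (last e ≤ srpt (init e) → srpt e ≡ last e))
lemma2p2 (suc k) _ e (inv , _) e≢id =
  map (trans srpt-e ∘_) (trans srpt-e ∘_) (srpt-∷ʳ (init e) (last e) (subst IsInvSeq e≡ inv) (e≢id ∘ trans e≡))
  where
  e≡ : e ≡ init e ∷ʳ last e
  e≡ = proj₂ (proj₂ (initLast e))
  srpt-e : srpt e ≡ srpt (init e ∷ʳ last e)
  srpt-e = cong srpt e≡
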